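{- Let $K$ be a field of characteristic $0$, $e\ge2$, and $A=[a_{i,j}]$, $B=[b_{i,j}]\in M_e(K)$ with indices in $\mathbb{Z}/e\mathbb{Z}$; write $A[i,j]=a_{i,j}$. For every $d\in(\mathbb{Z}/e\mathbb{Z})^\times$ and all $i,j$, \[ (B\overset{d}{\ast}A)[i,j]=(A\overset{d^{ -1}}{\ast}B)[-d^{ -1}i,-d^{ -1}j]. \] In particular $A\overset{ -1}{\ast}B=B\overset{ -1}{\ast}A$.
   Context: For $A=[a_{i,j}]$, $B=[b_{i,j}]\in M_e(K)$ (indices read modulo $e$) and $d\in\mathbb{Z}/e\mathbb{Z}\setminus\{0\}$, the $d$-composition is $A\overset{d}{\ast}B=\big[\sum_{s=0}^{e-1}\sum_{t=0}^{e-1}a_{s,t}b_{ds+i,dt+j}\big]_{0\le i,j\le e-1}$. -}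

module Defs where

open import Level using (_⊔_)
open import Data.Nat using (ℕ; zero; suc; _∸_; NonZero) renaming (_+_ to _+ℕ_; _*_ to _*ℕ_)
open import Data.Nat.DivMod using (_mod_)
open import Data.Fin using (Fin; toℕ) renaming (zero to fzero; suc to fsuc)
open import Data.Product using (Σ; _×_)
open import Relation.Binary.PropositionalEquality using (_≡_)
open import Relation.Nullary using (¬_)
open import Algebra.Bundles using (CommutativeRing)
import Algebra.Definitions.RawMonoid as RawMonoidDefs

-- Arithmetic of ℤ/eℤ, represented by Fin e (residues 0,…,e-1).

module ZMod (e : ℕ) .{{_ : NonZero e}} where

  _⊕_ : Fin e → Fin e → Fin e
  a ⊕ b = (toℕ a +ℕ toℕ b) mod e

  _⊗_ : Fin e → Fin e → Fin e
  a ⊗ b = (toℕ a *ℕ toℕ b) mod e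

  ⊖_ : Fin e → Fin e
  ⊖ a = (e ∸ toℕ a) mod e

  one : Fin e
  one = 1 mod e

  IsInverse : Fin e → Fin e → Set
  IsInverse d d' = d ⊗ d' ≡ one

  minusOne : Fin e
  minusOne = ⊖ one

module _ {c ℓ} (R : CommutativeRing c ℓ) where
  open CommutativeRing R

  record IsField : Set (c ⊔ ℓ) where
    field
      0≉1     : ¬ (0# ≈ 1#)
      inverse : ∀ x → ¬ (x ≈ 0#) → Σ Carrier λ y → x * y ≈ 1#

  open RawMonoidDefs +-rawMonoid using () renaming (_×_ to _·ℕ_)

  CharZero : Set ℓ
  CharZero = ∀ (n : ℕ) → (n ·ℕ 1#) ≈ 0# → n ≡ 0

  ∑ : ∀ {n} → (Fin n → Carrier) → Carrier
  ∑ {zero}  f = 0#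
  ∑ {suc n} f = f fzero + ∑ (λ i → f (fsuc i))

  Mat : ℕ → Set c
  Mat e = Fin e → Fin e → Carrier

  dcomp : (e : ℕ) .{{_ : NonZero e}} → Fin e → Mat e → Mat e → Mat e
  dcomp e d A B i j =
    ∑ (λ s → ∑ (λ t → A s t * B ((d ⊗ s) ⊕ i) ((d ⊗ t) ⊕ j)))
    where open ZMod e

{-# OPTIONS --safe #-}
module Submission where

-- Reindex both sums of (A ∗[d⁻¹] B)[−d⁻¹ i, −d⁻¹ j] along the affine bijections s ↦ d s + i
-- and t ↦ d t + j of ℤ/eℤ, whose inverses are u ↦ d⁻¹ u − d⁻¹ i and v ↦ d⁻¹ v − d⁻¹ j:
-- the summand becomes a_{du+i, dv+j} b_{u,v}, which is the summand of (B ∗[d] A)[i, j].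
-- For d = −1 we have d⁻¹ = −1 and −d⁻¹ i = i.

open import Defs
open import Level using (Level)
open import Data.Nat as Nat using (ℕ; _≤_; NonZero; _%_; _∸_)
open import Data.Nat.DivMod using (_mod_; %-distribˡ-+; %-distribˡ-*; m<n⇒m%n≡m; n%n≡0; m*n%n≡0; m%n%n≡m%n)
open import Data.Nat.Properties using (m+[n∸m]≡n; <⇒≤; +-comm; *-identityˡ)
open import Data.Nat.Tactic.RingSolver using (solve)
open import Data.Fin using (Fin; toℕ) renaming (zero to fzero; suc to fsuc)
open import Data.Fin.Properties using (toℕ-injective; toℕ-fromℕ<; toℕ<n)
open import Data.Fin.Permutation using (Permutation; permutation; _⟨$⟩ʳ_)
open import Data.List using ([]; _∷_)
open import Data.Product using (_×_; _,_)
open import Algebra.Bundles using (CommutativeRing)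
open import Relation.Binary.Bundles using (Setoid)
open import Relation.Binary.PropositionalEquality as ≡ using (_≡_; cong; cong₂)
import Relation.Binary.Reasoning.Setoid as SetoidReasoning
import Algebra.Properties.CommutativeMonoid.Sum as CommutativeMonoidSum

module Congruence (e : ℕ) .{{_ : NonZero e}} where
  open Nat using (_+_; _*_)
  open ZMod e

  -- A record rather than _≡_ on (_% e), so that m and n can be inferred from m ≋ n.
  infix 4 _≋_
  record _≋_ (m n : ℕ) : Set where
    constructor mk≋
    field %-≡ : m % e ≡ n % e
  open _≋_

  ≋-setoid : Setoid _ _
  ≋-setoid = record
    { _≈_ = _≋_
    ; isEquivalence = record
      { refl = mk≋ ≡.refl
      ; sym = λ p → mk≋ (≡.sym (%-≡ p))
      ; trans = λ p q → mk≋ (≡.trans (%-≡ p) (%-≡ q))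
      }
    }

  open Setoid ≋-setoid public using () renaming (refl to ≋-refl; sym to ≋-sym; trans to ≋-trans; reflexive to ≋-reflexive)

  +-cong-≋ : ∀ {m m′ n n′} → m ≋ m′ → n ≋ n′ → m + n ≋ m′ + n′
  +-cong-≋ {m} {m′} {n} {n′} (mk≋ p) (mk≋ q) = mk≋ (begin
    (m + n) % e                  ≡⟨ %-distribˡ-+ m n e ⟩
    (m % e + n % e) % e          ≡⟨ cong₂ (λ x y → (x + y) % e) p q ⟩
    (m′ % e + n′ % e) % e        ≡⟨ %-distribˡ-+ m′ n′ e ⟨
    (m′ + n′) % e                ∎)
    where open ≡.≡-Reasoning

  *-cong-≋ : ∀ {m m′ n n′} → m ≋ m′ → n ≋ n′ → m * n ≋ m′ * n′
  *-cong-≋ {m} {m′} {n} {n′} (mk≋ p) (mk≋ q) = mk≋ (begin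
    (m * n) % e                  ≡⟨ %-distribˡ-* m n e ⟩
    (m % e * (n % e)) % e        ≡⟨ cong₂ (λ x y → (x * y) % e) p q ⟩
    (m′ % e * (n′ % e)) % e      ≡⟨ %-distribˡ-* m′ n′ e ⟨
    (m′ * n′) % e                ∎)
    where open ≡.≡-Reasoning

  +-congˡ-≋ : ∀ m {n n′} → n ≋ n′ → m + n ≋ m + n′
  +-congˡ-≋ m = +-cong-≋ (≋-refl {m})

  +-congʳ-≋ : ∀ {m m′} n → m ≋ m′ → m + n ≋ m′ + n
  +-congʳ-≋ n p = +-cong-≋ p (≋-refl {n})

  *-congˡ-≋ : ∀ m {n n′} → n ≋ n′ → m * n ≋ m * n′
  *-congˡ-≋ m = *-cong-≋ (≋-refl {m})

  *-congʳ-≋ : ∀ {m m′} n → m ≋ m′ → m * n ≋ m′ * n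
  *-congʳ-≋ n p = *-cong-≋ p (≋-refl {n})

  toℕ-mod : ∀ m → toℕ (m mod e) ≋ m
  toℕ-mod m = mk≋ (≡.trans (cong (_% e) (toℕ-fromℕ< _)) (m%n%n≡m%n m e))

  toℕ-≋-injective : ∀ {a b : Fin e} → toℕ a ≋ toℕ b → a ≡ b
  toℕ-≋-injective {a} {b} (mk≋ p) =
    toℕ-injective (≡.trans (≡.sym (m<n⇒m%n≡m (toℕ<n a))) (≡.trans p (m<n⇒m%n≡m (toℕ<n b))))

  toℕ-⊕ : ∀ a b → toℕ (a ⊕ b) ≋ toℕ a + toℕ b
  toℕ-⊕ a b = toℕ-mod _

  toℕ-⊗ : ∀ a b → toℕ (a ⊗ b) ≋ toℕ a * toℕ b
  toℕ-⊗ a b = toℕ-mod _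

  toℕ-one : toℕ one ≋ 1
  toℕ-one = toℕ-mod 1

  toℕ-⊖-inverse : ∀ a → toℕ (⊖ a) + toℕ a ≋ 0
  toℕ-⊖-inverse a = begin
    toℕ (⊖ a) + toℕ a    ≈⟨ +-congʳ-≋ (toℕ a) (toℕ-mod (e ∸ toℕ a)) ⟩
    e ∸ toℕ a + toℕ a    ≡⟨ +-comm (e ∸ toℕ a) (toℕ a) ⟩
    toℕ a + (e ∸ toℕ a)  ≡⟨ m+[n∸m]≡n (<⇒≤ (toℕ<n a)) ⟩
    e                    ≈⟨ mk≋ (≡.trans (n%n≡0 e) (≡.sym (m*n%n≡0 0 e))) ⟩
    0                    ∎
    where open SetoidReasoning ≋-setoid

  inverse-unique-≋ : ∀ a b c → a + b ≋ 0 → b + c ≋ 0 → a ≋ c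
  inverse-unique-≋ a b c a+b≋0 b+c≋0 = begin
    a            ≡⟨ solve (a ∷ []) ⟩
    a + 0        ≈⟨ +-congˡ-≋ a (≋-sym b+c≋0) ⟩
    a + (b + c)  ≡⟨ solve (a ∷ b ∷ c ∷ []) ⟩
    (a + b) + c  ≈⟨ +-congʳ-≋ c a+b≋0 ⟩
    0 + c        ≡⟨ solve (c ∷ []) ⟩
    c            ∎
    where open SetoidReasoning ≋-setoid

  affine-inverseˡ-≋ : ∀ d d′ m → d * d′ ≋ 1 → m + d′ ≋ 0 → ∀ s k → d′ * (d * s + k) + m * k ≋ s
  affine-inverseˡ-≋ d d′ m dd′≋1 m+d′≋0 s k = begin
    d′ * (d * s + k) + m * k   ≡⟨ solve (d ∷ d′ ∷ m ∷ s ∷ k ∷ []) ⟩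
    d * d′ * s + (m + d′) * k  ≈⟨ +-cong-≋ (*-congʳ-≋ s dd′≋1) (*-congʳ-≋ k m+d′≋0) ⟩
    1 * s + 0 * k              ≡⟨ solve (s ∷ k ∷ []) ⟩
    s                          ∎
    where open SetoidReasoning ≋-setoid

  affine-inverseʳ-≋ : ∀ d d′ m → d * d′ ≋ 1 → m + d′ ≋ 0 → ∀ u k → d * (d′ * u + m * k) + k ≋ u
  affine-inverseʳ-≋ d d′ m dd′≋1 m+d′≋0 u k = begin
    d * (d′ * u + m * k) + k           ≡⟨ solve (d ∷ d′ ∷ m ∷ u ∷ k ∷ []) ⟩
    d * (d′ * u + m * k) + 1 * k       ≈⟨ +-congˡ-≋ (d * (d′ * u + m * k)) (*-congʳ-≋ k (≋-sym dd′≋1)) ⟩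
    d * (d′ * u + m * k) + d * d′ * k  ≡⟨ solve (d ∷ d′ ∷ m ∷ u ∷ k ∷ []) ⟩
    d * d′ * u + d * (m + d′) * k      ≈⟨ +-cong-≋ (*-congʳ-≋ u dd′≋1) (*-congʳ-≋ k (*-congˡ-≋ d m+d′≋0)) ⟩
    1 * u + d * 0 * k                  ≡⟨ solve (d ∷ u ∷ k ∷ []) ⟩
    u                                  ∎
    where open SetoidReasoning ≋-setoid

  minus-one-squared-≋ : ∀ n → n + 1 ≋ 0 → n * n ≋ 1
  minus-one-squared-≋ n n+1≋0 = inverse-unique-≋ (n * n) n 1 n*n+n≋0 n+1≋0
    where
      open SetoidReasoning ≋-setoid
      n*n+n≋0 : n * n + n ≋ 0
      n*n+n≋0 = begin
        n * n + n    ≡⟨ solve (n ∷ []) ⟩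
        n * (n + 1)  ≈⟨ *-congˡ-≋ n n+1≋0 ⟩
        n * 0        ≡⟨ solve (n ∷ []) ⟩
        0            ∎

module Affine (e : ℕ) .{{_ : NonZero e}} where
  open Nat using (_+_; _*_)
  open ZMod e
  open Congruence e

  affine : Fin e → Fin e → Fin e → Fin e
  affine a b s = (a ⊗ s) ⊕ b

  toℕ-affine : ∀ a b s → toℕ (affine a b s) ≋ toℕ a * toℕ s + toℕ b
  toℕ-affine a b s = ≋-trans (toℕ-⊕ (a ⊗ s) b) (+-congʳ-≋ (toℕ b) (toℕ-⊗ a s))

  module _ (d d′ : Fin e) (inv : IsInverse d d′) (k : Fin e) where
    private
      dd′≋1 : toℕ d * toℕ d′ ≋ 1
      dd′≋1 = ≋-trans (≋-sym (toℕ-⊗ d d′)) (≋-trans (≋-reflexive (cong toℕ inv)) toℕ-one)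

      toℕ-back : ∀ u → toℕ (affine d′ ((⊖ d′) ⊗ k) u) ≋ toℕ d′ * toℕ u + toℕ (⊖ d′) * toℕ k
      toℕ-back u = ≋-trans (toℕ-affine d′ _ u) (+-congˡ-≋ (toℕ d′ * toℕ u) (toℕ-⊗ (⊖ d′) k))

    affine-inverseˡ : ∀ s → affine d′ ((⊖ d′) ⊗ k) (affine d k s) ≡ s
    affine-inverseˡ s = toℕ-≋-injective
      (≋-trans (toℕ-back (affine d k s)) (≋-trans (+-congʳ-≋ _ (*-congˡ-≋ (toℕ d′) (toℕ-affine d k s)))
        (affine-inverseˡ-≋ (toℕ d) (toℕ d′) (toℕ (⊖ d′)) dd′≋1 (toℕ-⊖-inverse d′) (toℕ s) (toℕ k))))

    affine-inverseʳ : ∀ u → affine d k (affine d′ ((⊖ d′) ⊗ k) u) ≡ u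
    affine-inverseʳ u = toℕ-≋-injective
      (≋-trans (toℕ-affine d k _) (≋-trans (+-congʳ-≋ (toℕ k) (*-congˡ-≋ (toℕ d) (toℕ-back u)))
        (affine-inverseʳ-≋ (toℕ d) (toℕ d′) (toℕ (⊖ d′)) dd′≋1 (toℕ-⊖-inverse d′) (toℕ u) (toℕ k))))

    affinePermutation : Permutation e e
    affinePermutation = permutation (affine d k) (affine d′ ((⊖ d′) ⊗ k)) affine-inverseʳ affine-inverseˡ

module MinusOne (e : ℕ) .{{_ : NonZero e}} where
  open Nat using (_+_; _*_)
  open ZMod e
  open Congruence e

  private
    toℕ-minusOne+1≋0 : toℕ minusOne + 1 ≋ 0
    toℕ-minusOne+1≋0 = ≋-trans (+-congˡ-≋ (toℕ minusOne) (≋-sym toℕ-one)) (toℕ-⊖-inverse one)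

  minusOne-selfInverse : IsInverse minusOne minusOne
  minusOne-selfInverse = toℕ-≋-injective
    (≋-trans (toℕ-⊗ minusOne minusOne)
      (≋-trans (minus-one-squared-≋ (toℕ minusOne) toℕ-minusOne+1≋0) (≋-sym toℕ-one)))

  ⊖minusOne⊗i≡i : ∀ i → (⊖ minusOne) ⊗ i ≡ i
  ⊖minusOne⊗i≡i i = toℕ-≋-injective
    (≋-trans (toℕ-⊗ (⊖ minusOne) i)
      (≋-trans (*-congʳ-≋ (toℕ i) ⊖minusOne≋1) (≋-reflexive (*-identityˡ (toℕ i)))))
    where
      ⊖minusOne≋1 : toℕ (⊖ minusOne) ≋ 1
      ⊖minusOne≋1 = inverse-unique-≋ (toℕ (⊖ minusOne)) (toℕ minusOne) 1
        (toℕ-⊖-inverse minusOne) toℕ-minusOne+1≋0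

module Composition {c ℓ : Level} (K : CommutativeRing c ℓ) where
  open CommutativeRing K
  open SetoidReasoning setoid
  module Sum = CommutativeMonoidSum +-commutativeMonoid

  ∑≡sum : ∀ {n} (f : Fin n → Carrier) → ∑ K f ≡ Sum.sum f
  ∑≡sum {Nat.zero} f = ≡.refl
  ∑≡sum {Nat.suc n} f = cong (f fzero +_) (∑≡sum (λ i → f (fsuc i)))

  ∑-cong : ∀ {n} {f g : Fin n → Carrier} → (∀ i → f i ≈ g i) → ∑ K f ≈ ∑ K g
  ∑-cong {Nat.zero} f≈g = refl
  ∑-cong {Nat.suc n} f≈g = +-cong (f≈g fzero) (∑-cong (λ i → f≈g (fsuc i)))

  ∑-permute : ∀ {n} (f : Fin n → Carrier) (π : Permutation n n) → ∑ K f ≈ ∑ K (λ i → f (π ⟨$⟩ʳ i))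
  ∑-permute f π = begin
    ∑ K f                        ≡⟨ ∑≡sum f ⟩
    Sum.sum f                    ≈⟨ Sum.sum-permute f π ⟩
    Sum.sum (λ i → f (π ⟨$⟩ʳ i)) ≡⟨ ∑≡sum (λ i → f (π ⟨$⟩ʳ i)) ⟨
    ∑ K (λ i → f (π ⟨$⟩ʳ i))     ∎

  module _ (e : ℕ) .{{_ : NonZero e}} where
    open ZMod e
    open Affine e

    dcomp-swap : (A B : Mat K e) (d d⁻¹ : Fin e) → IsInverse d d⁻¹ →
      ∀ i j → dcomp K e d B A i j ≈ dcomp K e d⁻¹ A B ((⊖ d⁻¹) ⊗ i) ((⊖ d⁻¹) ⊗ j)
    dcomp-swap A B d d⁻¹ inv i j = sym (begin
      dcomp K e d⁻¹ A B ((⊖ d⁻¹) ⊗ i) ((⊖ d⁻¹) ⊗ j)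
        ≈⟨ ∑-permute _ (affinePermutation d d⁻¹ inv i) ⟩
      ∑ K (λ u → ∑ K (λ t → A (affine d i u) t * B (back i (affine d i u)) (back j t)))
        ≈⟨ ∑-cong (λ u → ∑-permute (λ t → A (affine d i u) t * B (back i (affine d i u)) (back j t))
                                   (affinePermutation d d⁻¹ inv j)) ⟩
      ∑ K (λ u → ∑ K (λ v → A (affine d i u) (affine d j v) * B (back i (affine d i u)) (back j (affine d j v))))
        ≈⟨ ∑-cong (λ u → ∑-cong (λ v → trans (*-comm _ _)
             (reflexive (cong₂ (λ x y → B x y * A (affine d i u) (affine d j v))
               (affine-inverseˡ d d⁻¹ inv i u) (affine-inverseˡ d d⁻¹ inv j v))))) ⟩
      dcomp K e d B A i j ∎)
      where
        back : Fin e → Fin e → Fin e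
        back k = affine d⁻¹ ((⊖ d⁻¹) ⊗ k)

proposition3p1 : ∀ {c ℓ : Level} (K : CommutativeRing c ℓ) → IsField K → CharZero K →
    (e : ℕ) .{{_ : NonZero e}} → 2 ≤ e →
    (A B : Mat K e) →
    ((d d⁻¹ : Fin e) → ZMod.IsInverse e d d⁻¹ → (i j : Fin e) →
      CommutativeRing._≈_ K (dcomp K e d B A i j)
        (dcomp K e d⁻¹ A B (ZMod._⊗_ e (ZMod.⊖_ e d⁻¹) i) (ZMod._⊗_ e (ZMod.⊖_ e d⁻¹) j)))
    × ((i j : Fin e) →
      CommutativeRing._≈_ K (dcomp K e (ZMod.minusOne e) A B i j) (dcomp K e (ZMod.minusOne e) B A i j))
proposition3p1 K _ _ e _ A B =
  dcomp-swap e A B ,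
  λ i j → begin
    dcomp K e minusOne A B i j
      ≈⟨ dcomp-swap e B A minusOne minusOne minusOne-selfInverse i j ⟩
    dcomp K e minusOne B A ((⊖ minusOne) ⊗ i) ((⊖ minusOne) ⊗ j)
      ≡⟨ cong₂ (dcomp K e minusOne B A) (⊖minusOne⊗i≡i i) (⊖minusOne⊗i≡i j) ⟩
    dcomp K e minusOne B A i j ∎
  where
    open Composition K
    open ZMod e
    open MinusOne e
    open SetoidReasoning (CommutativeRing.setoid K)
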